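{- For every finite sum $\mathbb A$ of expressions of the $\partial\lambda$-calculus with tests and every repetition-free list $\vec x$ of variables containing its free variables, $\llbracket\mathbb A\rrbracket_{\vec x}=\bigcup_{A\in\mathcal T(\mathbb A)}\llbracket A\rrbracket_{\vec x}$.
   Context: Syntax of the $\partial\lambda$-calculus with tests. Terms $M,N,L$, bags $P$, tests $V,W$: $M::=x\mid\lambda x.M\mid MP\mid\bar\tau(V)$, $P::=[L_1,\dots,L_k,\mathbb N^{!}]$, $V::=\tau[L_1,\dots,L_k]$ ($k\ge0$), where $\mathbb N$ is a finite sum (finite formal sum with idempotent addition, i.e. finite set) of terms; up to $\alpha$-equivalence. $[L_1,\dots,L_k]$ stands for $[L_1,\dots,L_k,0^!]$, $0$ being the empty sum. The expressions of the $\partial_0\lambda$-calculus with tests are those in which every bag has the form $[L_1,\dots,L_k]$. Taylor expansion. For a sum $\mathbb A$ of expressions of the $\partial\lambda$-calculus with tests, $\mathcal T(\mathbb A)$ is the set of $\partial_0\lambda$-expressions defined by: $\mathcal T(x)=\{x\}$; $\mathcal T(\lambda x.M)=\{\lambda x.M':M'\in\mathcal T(M)\}$; $\mathcal T(MP)=\{M'P':M'\in\mathcal T(M),P'\in\mathcal T(P)\}$; $\mathcal T(\bar\tau(V))=\{\bar\tau(V'):V'\in\mathcal T(V)\}$; $\mathcal T(\tau[M_1,\dots,M_k])=\{\tau[M'_1,\dots,M'_k]:M'_i\in\mathcal T(M_i)\}$; $\mathcal T([L_1,\dots,L_k,\mathbb N^!])=\{[L'_1,\dots,L'_k]\uplus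 P:L'_i\in\mathcal T(L_i),\ P\text{ a finite multiset of elements of }\mathcal T(\mathbb N)\}$; $\mathcal T(\sum_iA_i)=\bigcup_i\mathcal T(A_i)$. The model $\mathcal D$. $\mathcal M_f(S)$ = finite multisets over $S$; $D_0=\emptyset$, $D_{n+1}$ = $\mathbb N$-indexed sequences $(a_1,a_2,\dots)$ of elements of $\mathcal M_f(D_n)$ with all but finitely many empty; $\mathcal D=\bigcup_nD_n$; $a::(a_1,a_2,\dots):=(a,a_1,a_2,\dots)$; $*:=([\,],[\,],\dots)$; $\uplus$ on tuples componentwise. For a repetition-free list $\vec x=x_1,\dots,x_n$ containing the free variables: $\llbracket x_i\rrbracket_{\vec x}=\{(([\,],\dots,[\alpha],\dots,[\,]),\alpha):\alpha\in\mathcal D\}$ ($[\alpha]$ in position $i$); $\llbracket\lambda y.M\rrbracket_{\vec x}=\{(\vec a,b::\alpha):((\vec a,b),\alpha)\in\llbracket M\rrbracket_{\vec x,y}\}$; $\llbracket MP\rrbracket_{\vec x}=\{(\vec a_1\uplus\vec a_2,\alpha):\exists b\,(\vec a_1,b::\alpha)\in\llbracket M\rrbracket_{\vec x},(\vec a_2,b)\in\llbracket P\rrbracket_{\vec x}\}$; $\llbracket\bar\tau(V)\rrbracket_{\vec x}=\{(\vec a,*):\vec a\in\llbracket V\rrbracket_{\vec x}\}$; $\llbracket[L_1,\dots,L_k,\mathbb N^!]\rrbracket_{\vec x}=\{(\biguplus_{r=1}^{k+m}\vec a_r,[\beta_1,\dots,\beta_{k+m}]):m\ge0,(\vec a_j,\beta_j)\in\llbracket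 L_j\rrbracket_{\vec x}\ (j\le k),(\vec a_i,\beta_i)\in\llbracket\mathbb N\rrbracket_{\vec x}\ (k<i\le k+m)\}$; $\llbracket\tau[L_1,\dots,L_k]\rrbracket_{\vec x}=\{\biguplus_i\vec a_i:(\vec a_i,*)\in\llbracket L_i\rrbracket_{\vec x}\}$; sums as unions. -}

module Defs where

open import Data.Nat using (ℕ; suc)
open import Data.Fin using (Fin)
open import Data.List using (List; []; _∷_; _++_)
open import Data.List.Relation.Unary.All using (All)
open import Data.List.Relation.Unary.Any using (Any)
open import Data.List.Relation.Binary.Pointwise using (Pointwise)
open import Data.Vec using (Vec; replicate; _[_]≔_; zipWith)
  renaming (_∷_ to _∷ᵥ_)
import Data.Vec.Relation.Binary.Pointwise.Inductive as VP
open import Data.Product using (Σ; _×_)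
open import Data.Sum using (_⊎_)
open import Data.Empty using (⊥)

-- A finite sum of terms is represented by a List of terms (only its
-- set of elements matters: all uses are via unions / Any).
-- bag Ls N  represents  [L₁,…,Lₖ, N^!]  (Ls = L₁,…,Lₖ ; N the sum).
-- tau Ls    represents  τ[L₁,…,Lₖ].

mutual
  data Term (n : ℕ) : Set where
    var  : Fin n → Term n
    lam  : Term (suc n) → Term n
    app  : Term n → Bag n → Term n
    tbar : Test n → Term n

  data Bag (n : ℕ) : Set where
    bag : List (Term n) → List (Term n) → Bag n

  data Test (n : ℕ) : Set where
    tau : List (Term n) → Test n

-- Taylor expansion, as a relation:  Tt A A'  means  A' ∈ 𝒯(A).
-- (∂₀-expressions are those whose bags have an empty promoted sum.)

mutual
  data Tt {n : ℕ} : Term n → Term n → Set where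
    var  : (i : Fin n) → Tt (var i) (var i)
    lam  : {M M' : Term (suc n)} → Tt M M' → Tt (lam M) (lam M')
    app  : {M M' : Term n} {P P' : Bag n} → Tt M M' → Tb P P' →
           Tt (app M P) (app M' P')
    tbar : {V V' : Test n} → Tv V V' → Tt (tbar V) (tbar V')

  data Tb {n : ℕ} : Bag n → Bag n → Set where
    bag : {Ls Ls' : List (Term n)} {N : List (Term n)} →
          Pointwise Tt Ls Ls' →
          (ps : List (Term n)) → All (λ p → Any (λ M → Tt M p) N) ps →
          Tb (bag Ls N) (bag (Ls' ++ ps) [])

  data Tv {n : ℕ} : Test n → Test n → Set where
    tau : {Ls Ls' : List (Term n)} → Pointwise Tt Ls Ls' →
          Tv (tau Ls) (tau Ls')

TtSum : {n : ℕ} → List (Term n) → Term n → Set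
TtSum A A' = Any (λ M → Tt M A') A

TbSum : {n : ℕ} → List (Bag n) → Bag n → Set
TbSum A A' = Any (λ P → Tb P A') A

TvSum : {n : ℕ} → List (Test n) → Test n → Set
TvSum A A' = Any (λ V → Tv V A') A

-- An element of 𝒟 is a sequence of finite multisets of
-- elements of 𝒟, all but finitely many empty: represented by a finite
-- list of multisets (the rest being empty); multisets are lists.
-- Equality of 𝒟 is the equivalence _≈D_ below (multisets up to
-- permutation, sequences up to trailing empty multisets).

data D : Set where
  seq : List (List D) → D

mutual
  data _≈M_ : List D → List D → Set where
    []  : [] ≈M []
    cons : {x y : D} {xs ys₁ ys₂ : List D} → x ≈D y → xs ≈M (ys₁ ++ ys₂) →
           (x ∷ xs) ≈M (ys₁ ++ (y ∷ ys₂))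

  data _≈S_ : List (List D) → List (List D) → Set where
    nil  : [] ≈S []
    nilL : {ms : List (List D)} → [] ≈S ms → [] ≈S ([] ∷ ms)
    nilR : {ms : List (List D)} → ms ≈S [] → ([] ∷ ms) ≈S []
    cons : {m m' : List D} {ms ms' : List (List D)} →
           m ≈M m' → ms ≈S ms' → (m ∷ ms) ≈S (m' ∷ ms')

  data _≈D_ : D → D → Set where
    seq : {s s' : List (List D)} → s ≈S s' → seq s ≈D seq s'

_::_ : List D → D → D
a :: seq s = seq (a ∷ s)

star : D
star = seq []

Env : ℕ → Set
Env n = Vec (List D) n

_≈E_ : {n : ℕ} → Env n → Env n → Set
_≈E_ = VP.Pointwise _≈M_

_⊎E_ : {n : ℕ} → Env n → Env n → Env n
_⊎E_ = zipWith _++_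

emptyE : (n : ℕ) → Env n
emptyE n = replicate n []

single : {n : ℕ} → Fin n → D → Env n
single {n} i α = replicate n [] [ i ]≔ (α ∷ [])

-- finitely many elements of a relation, collected into a multiset
data Star {n : ℕ} (R : Env n → D → Set) : Env n → List D → Set where
  snil  : {e : Env n} {βs : List D} → e ≈E emptyE n → βs ≈M [] → Star R e βs
  scons : {e e₁ e₂ : Env n} {a : D} {bs βs : List D} →
          e ≈E (e₁ ⊎E e₂) → R e₁ a → Star R e₂ bs → βs ≈M (a ∷ bs) →
          Star R e βs

mutual
  ⟦_⟧t : {n : ℕ} → Term n → Env n → D → Set
  ⟦ var i ⟧t e α = e ≈E single i α
  ⟦ lam M ⟧t e α = Σ (List D) λ b → Σ D λ β → (α ≈D (b :: β)) × ⟦ M ⟧t (b ∷ᵥ e) β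
  ⟦ app M P ⟧t e α = Σ (Env _) λ e₁ → Σ (Env _) λ e₂ → Σ (List D) λ b →
    (e ≈E (e₁ ⊎E e₂)) × ⟦ M ⟧t e₁ (b :: α) × ⟦ P ⟧b e₂ b
  ⟦ tbar V ⟧t e α = (α ≈D star) × ⟦ V ⟧v e

  ⟦_⟧s : {n : ℕ} → List (Term n) → Env n → D → Set
  ⟦ [] ⟧s e α = ⊥
  ⟦ M ∷ N ⟧s e α = ⟦ M ⟧t e α ⊎ ⟦ N ⟧s e α

  ⟦_⟧b : {n : ℕ} → Bag n → Env n → List D → Set
  ⟦ bag Ls N ⟧b = bagSem Ls N

  bagSem : {n : ℕ} → List (Term n) → List (Term n) → Env n → List D → Set
  bagSem [] N e βs = Star ⟦ N ⟧s e βs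
  bagSem (L ∷ Ls) N e βs = Σ (Env _) λ e₁ → Σ (Env _) λ e₂ → Σ D λ a →
    Σ (List D) λ bs → (e ≈E (e₁ ⊎E e₂)) × ⟦ L ⟧t e₁ a × bagSem Ls N e₂ bs ×
    (βs ≈M (a ∷ bs))

  ⟦_⟧v : {n : ℕ} → Test n → Env n → Set
  ⟦ tau Ls ⟧v = tauSem Ls

  tauSem : {n : ℕ} → List (Term n) → Env n → Set
  tauSem [] e = e ≈E emptyE _
  tauSem (L ∷ Ls) e = Σ (Env _) λ e₁ → Σ (Env _) λ e₂ →
    (e ≈E (e₁ ⊎E e₂)) × ⟦ L ⟧t e₁ star × tauSem Ls e₂

⟦_⟧bs : {n : ℕ} → List (Bag n) → Env n → List D → Set
⟦ A ⟧bs e βs = Any (λ P → ⟦ P ⟧b e βs) A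

⟦_⟧vs : {n : ℕ} → List (Test n) → Env n → Set
⟦ A ⟧vs e = Any (λ V → ⟦ V ⟧v e) A

-- The only clause where the two sides differ
-- in shape is the promoted part N^! of a bag: ⟦ N^! ⟧ collects finitely many
-- points of ⟦ N ⟧, and each of them is a point of ⟦ N' ⟧ for a single
-- N' ∈ 𝒯(N); these N' are exactly the finitely many extra elements that
-- 𝒯 appends to the bag.
module Submission where

open import Defs
open import Data.Nat using (ℕ)
open import Data.List using (List; []; _∷_; _++_)
open import Data.Product using (Σ; _×_; _,_)
open import Data.Sum using (inj₁; inj₂)
open import Data.List.Relation.Unary.All using (All; []; _∷_)
open import Data.List.Relation.Unary.Any using (Any; here; there)
import Data.List.Relation.Unary.Any as Any
open import Data.List.Relation.Binary.Pointwise using (Pointwise; []; _∷_)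

mutual
  Tt-complete : ∀ {n} (M : Term n) {e α} → ⟦ M ⟧t e α →
                Σ (Term n) λ M' → Tt M M' × ⟦ M' ⟧t e α
  Tt-complete (var i) s = var i , var i , s
  Tt-complete (lam M) (b , β , α≈ , s) with Tt-complete M s
  ... | M' , t , s' = lam M' , lam t , b , β , α≈ , s'
  Tt-complete (app M P) (e₁ , e₂ , b , e≈ , sM , sP)
    with Tt-complete M sM | Tb-complete P sP
  ... | M' , t , sM' | P' , u , sP' =
    app M' P' , app t u , e₁ , e₂ , b , e≈ , sM' , sP'
  Tt-complete (tbar V) (α≈ , s) with Tv-complete V s
  ... | V' , t , s' = tbar V' , tbar t , α≈ , s'

  Tv-complete : ∀ {n} (V : Test n) {e} → ⟦ V ⟧v e →
                Σ (Test n) λ V' → Tv V V' × ⟦ V' ⟧v e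
  Tv-complete (tau Ls) s with tauSem-complete Ls s
  ... | Ls' , ts , s' = tau Ls' , tau ts , s'

  tauSem-complete : ∀ {n} (Ls : List (Term n)) {e} → tauSem Ls e →
                    Σ (List (Term n)) λ Ls' → Pointwise Tt Ls Ls' × tauSem Ls' e
  tauSem-complete [] s = [] , [] , s
  tauSem-complete (L ∷ Ls) (e₁ , e₂ , e≈ , sL , sLs)
    with Tt-complete L sL | tauSem-complete Ls sLs
  ... | L' , t , sL' | Ls' , ts , sLs' =
    L' ∷ Ls' , t ∷ ts , e₁ , e₂ , e≈ , sL' , sLs'

  Tb-complete : ∀ {n} (P : Bag n) {e β} → ⟦ P ⟧b e β →
                Σ (Bag n) λ P' → Tb P P' × ⟦ P' ⟧b e β
  Tb-complete (bag Ls N) s with bagSem-complete Ls N s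
  ... | Ls' , ps , ts , tps , s' = bag (Ls' ++ ps) [] , bag ts ps tps , s'

  bagSem-complete : ∀ {n} (Ls N : List (Term n)) {e β} → bagSem Ls N e β →
                    Σ (List (Term n)) λ Ls' → Σ (List (Term n)) λ ps →
                    Pointwise Tt Ls Ls' × All (TtSum N) ps ×
                    bagSem (Ls' ++ ps) [] e β
  bagSem-complete [] N s with Star-complete N s
  ... | ps , tps , s' = [] , ps , [] , tps , s'
  bagSem-complete (L ∷ Ls) N (e₁ , e₂ , a , bs , e≈ , sL , sLs , β≈)
    with Tt-complete L sL | bagSem-complete Ls N sLs
  ... | L' , t , sL' | Ls' , ps , ts , tps , sLs' =
    L' ∷ Ls' , ps , t ∷ ts , tps , e₁ , e₂ , a , bs , e≈ , sL' , sLs' , β≈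

  Star-complete : ∀ {n} (N : List (Term n)) {e β} → Star ⟦ N ⟧s e β →
                  Σ (List (Term n)) λ ps → All (TtSum N) ps × bagSem ps [] e β
  Star-complete N (snil e≈ β≈) = [] , [] , snil e≈ β≈
  Star-complete N (scons {e₁ = e₁} {e₂ = e₂} {a = a} {bs = bs} e≈ sa sbs β≈)
    with TtSum-complete N sa | Star-complete N sbs
  ... | p , tp , sa' | ps , tps , sbs' =
    p ∷ ps , tp ∷ tps , e₁ , e₂ , a , bs , e≈ , sa' , sbs' , β≈

  TtSum-complete : ∀ {n} (N : List (Term n)) {e α} → ⟦ N ⟧s e α →
                   Σ (Term n) λ M' → TtSum N M' × ⟦ M' ⟧t e α
  TtSum-complete (M ∷ N) (inj₁ s) with Tt-complete M s
  ... | M' , t , s' = M' , here t , s'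
  TtSum-complete (M ∷ N) (inj₂ s) with TtSum-complete N s
  ... | M' , t , s' = M' , there t , s'

mutual
  Tt-sound : ∀ {n} {M M' : Term n} {e α} → Tt M M' → ⟦ M' ⟧t e α → ⟦ M ⟧t e α
  Tt-sound (var i) s = s
  Tt-sound (lam t) (b , β , α≈ , s) = b , β , α≈ , Tt-sound t s
  Tt-sound (app t u) (e₁ , e₂ , b , e≈ , sM , sP) =
    e₁ , e₂ , b , e≈ , Tt-sound t sM , Tb-sound u sP
  Tt-sound (tbar t) (α≈ , s) = α≈ , Tv-sound t s

  Tv-sound : ∀ {n} {V V' : Test n} {e} → Tv V V' → ⟦ V' ⟧v e → ⟦ V ⟧v e
  Tv-sound (tau ts) s = tauSem-sound ts s

  tauSem-sound : ∀ {n} {Ls Ls' : List (Term n)} {e} →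
                 Pointwise Tt Ls Ls' → tauSem Ls' e → tauSem Ls e
  tauSem-sound [] s = s
  tauSem-sound (t ∷ ts) (e₁ , e₂ , e≈ , sL , sLs) =
    e₁ , e₂ , e≈ , Tt-sound t sL , tauSem-sound ts sLs

  Tb-sound : ∀ {n} {P P' : Bag n} {e β} → Tb P P' → ⟦ P' ⟧b e β → ⟦ P ⟧b e β
  Tb-sound (bag ts ps tps) s = bagSem-sound ts ps tps s

  bagSem-sound : ∀ {n} {Ls Ls' N : List (Term n)} {e β} →
                 Pointwise Tt Ls Ls' → (ps : List (Term n)) → All (TtSum N) ps →
                 bagSem (Ls' ++ ps) [] e β → bagSem Ls N e β
  bagSem-sound [] ps tps s = Star-sound ps tps s
  bagSem-sound (t ∷ ts) ps tps (e₁ , e₂ , a , bs , e≈ , sL , sLs , β≈) =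
    e₁ , e₂ , a , bs , e≈ , Tt-sound t sL , bagSem-sound ts ps tps sLs , β≈

  Star-sound : ∀ {n} {N : List (Term n)} {e β} (ps : List (Term n)) →
               All (TtSum N) ps → bagSem ps [] e β → Star ⟦ N ⟧s e β
  Star-sound [] [] (snil e≈ β≈) = snil e≈ β≈
  Star-sound [] [] (scons _ () _ _)
  Star-sound (p ∷ ps) (tp ∷ tps) (e₁ , e₂ , a , bs , e≈ , sp , sps , β≈) =
    scons e≈ (TtSum-sound tp sp) (Star-sound ps tps sps) β≈

  TtSum-sound : ∀ {n} {N : List (Term n)} {M' : Term n} {e α} →
                TtSum N M' → ⟦ M' ⟧t e α → ⟦ N ⟧s e α
  TtSum-sound (here t) s = inj₁ (Tt-sound t s)
  TtSum-sound (there t) s = inj₂ (TtSum-sound t s)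

module _ {X : Set} {T : X → X → Set} {S : X → Set} where

  Any-complete : (∀ x → S x → Σ X λ x' → T x x' × S x') →
                 ∀ A → Any S A → Σ X λ x' → Any (λ x → T x x') A × S x'
  Any-complete complete (x ∷ A) (here s) with complete x s
  ... | x' , t , s' = x' , here t , s'
  Any-complete complete (x ∷ A) (there s) with Any-complete complete A s
  ... | x' , t , s' = x' , there t , s'

  Any-sound : (∀ {x x'} → T x x' → S x' → S x) →
              ∀ A → (Σ X λ x' → Any (λ x → T x x') A × S x') → Any S A
  Any-sound sound A (x' , t , s) = Any.map (λ u → sound u s) t

theorem8p4 :
    ((n : ℕ) (A : List (Term n)) (e : Env n) (α : D) →
      (⟦ A ⟧s e α → Σ (Term n) λ A' → TtSum A A' × ⟦ A' ⟧t e α)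
      × ((Σ (Term n) λ A' → TtSum A A' × ⟦ A' ⟧t e α) → ⟦ A ⟧s e α))
    × ((n : ℕ) (A : List (Bag n)) (e : Env n) (β : List D) →
      (⟦ A ⟧bs e β → Σ (Bag n) λ A' → TbSum A A' × ⟦ A' ⟧b e β)
      × ((Σ (Bag n) λ A' → TbSum A A' × ⟦ A' ⟧b e β) → ⟦ A ⟧bs e β))
    × ((n : ℕ) (A : List (Test n)) (e : Env n) →
      (⟦ A ⟧vs e → Σ (Test n) λ A' → TvSum A A' × ⟦ A' ⟧v e)
      × ((Σ (Test n) λ A' → TvSum A A' × ⟦ A' ⟧v e) → ⟦ A ⟧vs e))
theorem8p4 =
    (λ n A e α → TtSum-complete A , λ (_ , t , s) → TtSum-sound t s)
  , (λ n A e β → Any-complete (λ P → Tb-complete P) A , Any-sound Tb-sound A)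
  , (λ n A e → Any-complete (λ V → Tv-complete V) A , Any-sound Tv-sound A)
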